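{- Let $A$ be a set and let $(F(A),e,\cdot)$ together with $\eta_A\colon A\to F(A)$ be a free monoid on $A$. Let $\approx$ be a permutation relation on $F(A)$, and let $q\colon F(A)\twoheadrightarrow F(A)/{\approx}$ be the quotient map. Then $F(A)/{\approx}$, with unit $q(e)$, multiplication induced by $\cdot$, and generator map $q\circ\eta_A\colon A\to F(A)/{\approx}$, is the free commutative monoid on $A$: for every commutative monoid $X$, the map sending a monoid homomorphism $h\colon F(A)/{\approx}\to X$ to $h\circ q\circ\eta_A$ is an equivalence between monoid homomorphisms $F(A)/{\approx}\to X$ and functions $A\to X$; its inverse sends $f$ to the map $\widehat{f}$ induced on the quotient by the unique monoid homomorphism $f^\sharp\colon F(A)\to X$ extending $f$.
   Context: Free monoid: for every monoid $X$ and function $f\colon A\to X$ there is a unique monoid homomorphism $f^\sharp\colon F(A)\to X$ with $f^\sharp\circ\eta_A=f$ (precomposition with $\eta_A$ is an equivalence). A binary relation $\approx$ on $F(A)$ is a permutation relation if it is an equivalence relation; a congruence for $\cdot$ (if $a\approx b$ and $c\approx d$ then $a\cdot c\approx b\cdot d$); commutative ($a\cdot b\approx b\cdot a$ for all $a,b$); and respects extension (for every commutative monoid $X$, every $f\colon A\to X$ and all $a\approx b$, $f^\sharp(a)=f^\sharp(b)$). $F(A)/{\approx}$ denotes the set quotient. -}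

module Defs where

open import Level using (Level; _⊔_) renaming (suc to lsuc)
open import Algebra.Core using (Op₂)
open import Algebra.Structures using (IsMonoid; IsCommutativeMonoid)
open import Relation.Binary.Core using (Rel)
open import Relation.Binary.Structures using (IsEquivalence)
open import Relation.Binary.PropositionalEquality using (_≡_; _≗_)
open import Data.Product using (Σ; _×_; proj₁)
open import Function using (_∘_)

record Mon (ℓ : Level) : Set (lsuc ℓ) where
  field
    Carrier  : Set ℓ
    _∙_      : Op₂ Carrier
    ε        : Carrier
    isMonoid : IsMonoid _≡_ _∙_ ε

record CMon (ℓ : Level) : Set (lsuc ℓ) where
  field
    Carrier             : Set ℓ
    _∙_                 : Op₂ Carrier
    ε                   : Carrier
    isCommutativeMonoid : IsCommutativeMonoid _≡_ _∙_ ε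

  monoid : Mon ℓ
  monoid = record { Carrier = Carrier ; _∙_ = _∙_ ; ε = ε
                  ; isMonoid = IsCommutativeMonoid.isMonoid isCommutativeMonoid }

record IsMonHom {m x : Level} (M : Mon m) (X : Mon x)
                (h : Mon.Carrier M → Mon.Carrier X) : Set (m ⊔ x) where
  private
    module M = Mon M
    module X = Mon X
  field
    pres-ε : h M.ε ≡ X.ε
    pres-∙ : ∀ u v → h (u M.∙ v) ≡ h u X.∙ h v

-- (F, e, ·, η) is a free monoid on A, with respect to target monoids of
-- level x: for every monoid X and f : A → X there is a monoid homomorphism
-- f♯ with f♯ ∘ η = f, and it is unique (precomposition with η is an
-- equivalence; function equality is pointwise).
IsFreeMonoid : {a m : Level} (x : Level) (A : Set a) (F : Mon m)
               (η : A → Mon.Carrier F) → Set (a ⊔ m ⊔ lsuc x)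
IsFreeMonoid x A F η =
  (X : Mon x) (f : A → Mon.Carrier X) →
  Σ (Mon.Carrier F → Mon.Carrier X) λ g →
    IsMonHom F X g × (g ∘ η ≗ f) ×
    ((h : Mon.Carrier F → Mon.Carrier X) → IsMonHom F X h → h ∘ η ≗ f → h ≗ g)

sharp : {a m x : Level} {A : Set a} {F : Mon m} {η : A → Mon.Carrier F} →
        IsFreeMonoid x A F η → (X : Mon x) (f : A → Mon.Carrier X) →
        Mon.Carrier F → Mon.Carrier X
sharp free X f = proj₁ (free X f)

record IsPermutationRelation {a m x r : Level} {A : Set a} {F : Mon m}
         {η : A → Mon.Carrier F} (free : IsFreeMonoid x A F η)
         (_≈_ : Rel (Mon.Carrier F) r) : Set (a ⊔ m ⊔ lsuc x ⊔ r) where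
  open Mon F
  field
    isEquivalence : IsEquivalence _≈_
    congruence    : ∀ {u v w z} → u ≈ v → w ≈ z → (u ∙ w) ≈ (v ∙ z)
    commutative   : ∀ u v → (u ∙ v) ≈ (v ∙ u)
    respectsExt   : (X : CMon x) (f : A → CMon.Carrier X) {u v : Carrier} →
                    u ≈ v → sharp free (CMon.monoid X) f u ≡ sharp free (CMon.monoid X) f v

-- The quotient F(A)/≈ is represented as the setoid (F(A), ≈) (no quotient
-- types in --safe Agda without cubical).  A monoid homomorphism
-- F(A)/≈ → X is thus a map F(A) → X which is well defined on ≈-classes and
-- preserves unit q(e) and the induced multiplication.
record IsQuotHom {m r x : Level} (F : Mon m) (_≈_ : Rel (Mon.Carrier F) r)
                 (X : CMon x) (h : Mon.Carrier F → CMon.Carrier X)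
                 : Set (m ⊔ r ⊔ x) where
  field
    well-defined : ∀ {u v} → u ≈ v → h u ≡ h v
    isMonHom     : IsMonHom F (CMon.monoid X) h

{-# OPTIONS --safe #-}
-- The monoid laws of F(A) hold up to ≡ and hence up to ≈, which adds commutativity.
-- Since ≈ respects extension, f♯ descends to the quotient; conversely a homomorphism
-- out of the quotient is a homomorphism out of F(A), so freeness of F(A) makes it
-- equal to (h ∘ η)♯.
module Submission where

open import Defs
open import Level using (Level)
open import Algebra.Core using (Op₂)
open import Algebra.Structures using (IsMonoid; IsCommutativeMonoid)
open import Relation.Binary.Core using (Rel)
open import Relation.Binary.Structures using (IsEquivalence)
open import Relation.Binary.PropositionalEquality using (_≡_; _≗_; refl; sym)
open import Data.Product using (_×_; _,_; proj₁; proj₂)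
open import Function using (_∘_)

commutativeCongruence⇒isCommutativeMonoid :
  {c r : Level} {M : Set c} {_∙_ : Op₂ M} {ε : M} {_≈_ : Rel M r} →
  IsMonoid _≡_ _∙_ ε → IsEquivalence _≈_ →
  (∀ {u v w z} → u ≈ v → w ≈ z → (u ∙ w) ≈ (v ∙ z)) →
  (∀ u v → (u ∙ v) ≈ (v ∙ u)) →
  IsCommutativeMonoid _≈_ _∙_ ε
commutativeCongruence⇒isCommutativeMonoid isMonoid isEquivalence ∙-cong comm = record
  { isMonoid = record
    { isSemigroup = record
      { isMagma = record { isEquivalence = isEquivalence ; ∙-cong = ∙-cong }
      ; assoc   = λ u v w → reflexive (assoc u v w)
      }
    ; identity = (λ u → reflexive (identityˡ u)) , (λ u → reflexive (identityʳ u))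
    }
  ; comm = comm
  }
  where
  open IsMonoid isMonoid using (assoc; identityˡ; identityʳ)
  open IsEquivalence isEquivalence using (reflexive)

module FreeMonoid {a m x : Level} {A : Set a} {F : Mon m} {η : A → Mon.Carrier F}
                  (free : IsFreeMonoid x A F η) where

  sharp-isMonHom : (X : Mon x) (f : A → Mon.Carrier X) → IsMonHom F X (sharp free X f)
  sharp-isMonHom X f = proj₁ (proj₂ (free X f))

  sharp-∘-η : (X : Mon x) (f : A → Mon.Carrier X) → sharp free X f ∘ η ≗ f
  sharp-∘-η X f = proj₁ (proj₂ (proj₂ (free X f)))

  sharp-∘-η-unique : (X : Mon x) (h : Mon.Carrier F → Mon.Carrier X) →
                     IsMonHom F X h → sharp free X (h ∘ η) ≗ h
  sharp-∘-η-unique X h h-hom u =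
    sym (proj₂ (proj₂ (proj₂ (free X (h ∘ η)))) h h-hom (λ _ → refl) u)

  sharp-isQuotHom : {r : Level} {_≈_ : Rel (Mon.Carrier F) r} →
                    IsPermutationRelation free _≈_ →
                    (X : CMon x) (f : A → CMon.Carrier X) →
                    IsQuotHom F _≈_ X (sharp free (CMon.monoid X) f)
  sharp-isQuotHom perm X f = record
    { well-defined = IsPermutationRelation.respectsExt perm X f
    ; isMonHom     = sharp-isMonHom (CMon.monoid X) f
    }

proposition30 : {a m x r : Level} (A : Set a) (F : Mon m) (η : A → Mon.Carrier F)
    (free : IsFreeMonoid x A F η) (_≈_ : Rel (Mon.Carrier F) r) →
    IsPermutationRelation free _≈_ →
    IsCommutativeMonoid _≈_ (Mon._∙_ F) (Mon.ε F)
    × ((X : CMon x) →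
        ((f : A → CMon.Carrier X) → IsQuotHom F _≈_ X (sharp free (CMon.monoid X) f))
        × ((f : A → CMon.Carrier X) → sharp free (CMon.monoid X) f ∘ η ≗ f)
        × ((h : Mon.Carrier F → CMon.Carrier X) → IsQuotHom F _≈_ X h →
            sharp free (CMon.monoid X) (h ∘ η) ≗ h))
proposition30 A F η free _≈_ perm =
    commutativeCongruence⇒isCommutativeMonoid (Mon.isMonoid F) isEquivalence congruence commutative
  , λ X → sharp-isQuotHom perm X
        , sharp-∘-η (CMon.monoid X)
        , λ h h-quot → sharp-∘-η-unique (CMon.monoid X) h (IsQuotHom.isMonHom h-quot)
  where
  open IsPermutationRelation perm using (isEquivalence; congruence; commutative)
  open FreeMonoid free
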